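{- Let $p$ be a prime, let $m>n\geqslant1$ and $i\geqslant1$ be integers with $i\geqslant n/(m-n)$, and let $j\geqslant1$ be an integer not divisible by $p$. If $v_p(\alpha_p(m,n,i-1,j))\geqslant s_p(n,i-1,j)$, then also $v_p(\alpha_p(m,n,i,j))\geqslant s_p(n,i,j)$.
   Context: $s_p(m,i,j)=\operatorname{card}(\{1,2,\dots,m(i+1)\}\cap\{j,pj,p^2j,\dots\})$. $\alpha_p(m,n,i,j)$ denotes a $p$-adic integer with $v_p(\alpha_p(m,n,i,j))=\sum_{0\leqslant h<i}(s_p(m,h,j)-s_p(n,h,j))$. -}

module Defs where

open import Data.Nat using (ℕ; zero; suc; _+_; _*_; _^_; _≤?_)
open import Data.List using (List; length; filter; upTo)
open import Data.Integer as ℤ using (ℤ; +_)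

-- s_p(m,i,j) = card({1,…,m(i+1)} ∩ {j, pj, p²j, …}).
-- For p ≥ 2 and j ≥ 1 the elements p^k·j are pairwise distinct and
-- p^k·j ≤ N forces k < N, so this cardinality is the number of
-- exponents k ∈ {0,…,N} with p^k·j ≤ N, where N = m(i+1).
s : ℕ → ℕ → ℕ → ℕ → ℕ
s p m i j = length (filter (λ k → p ^ k * j ≤? N) (upTo (suc N)))
  where N = m * (i + 1)

Σ< : ℕ → (ℕ → ℤ) → ℤ
Σ< zero    f = + 0
Σ< (suc i) f = Σ< i f ℤ.+ f i

-- v_p(α_p(m,n,i,j)) = Σ_{0≤h<i} (s_p(m,h,j) − s_p(n,h,j)),
-- the only property of α_p(m,n,i,j) given in the context.
vα : ℕ → ℕ → ℕ → ℕ → ℕ → ℤ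
vα p m n i j = Σ< i (λ h → (+ s p m h j) ℤ.- (+ s p n h j))

{-# OPTIONS --safe #-}
module Submission where

-- By definition vα(i) = vα(i − 1) + s(m, i − 1) − s(n, i − 1), so the hypothesis
-- gives vα(i) ≥ s(m, i − 1). The condition i ≥ n/(m − n) means n(i + 1) ≤ m·i,
-- and s(·, i) counts the k with p^k·j ≤ (·)(i + 1), hence is monotone in that
-- bound: s(n, i) ≤ s(m, i − 1).

open import Defs
open import Data.Nat using (ℕ; _*_; _∸_; _≤_; _<_)
open import Data.Nat.Divisibility using (_∣_)
open import Data.Nat.Primality using (Prime)
open import Data.Integer as ℤ using (+_)
open import Relation.Nullary using (¬_)

open import Data.Nat using (suc; _+_; _^_; _≤′_; _≤?_; s≤s; ≤′-refl; ≤′-step)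
import Data.Nat.Properties as ℕ
import Data.Integer.Properties as ℤ
import Data.Nat.Tactic.RingSolver as ℕ-Solver
import Data.Integer.Tactic.RingSolver as ℤ-Solver
open import Data.List using ([]; _∷_; [_]; length; filter; upTo)
open import Data.List.Properties using (upTo-∷ʳ)
open import Data.List.Relation.Binary.Sublist.Propositional using (_⊆_; ⊆-refl; ⊆-trans)
open import Data.List.Relation.Binary.Sublist.Propositional.Properties
  using (filter⁺; length-mono-≤; ++⁺ʳ)
open import Relation.Binary.PropositionalEquality using (_≡_; refl; cong; subst)

upTo-mono-≤′ : ∀ {a b} → a ≤′ b → upTo a ⊆ upTo b
upTo-mono-≤′ ≤′-refl = ⊆-refl
upTo-mono-≤′ {b = suc b} (≤′-step a≤′b) =
  ⊆-trans (upTo-mono-≤′ a≤′b) (subst (upTo b ⊆_) (upTo-∷ʳ b) (++⁺ʳ [ b ] ⊆-refl))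

upTo-mono-≤ : ∀ {a b} → a ≤ b → upTo a ⊆ upTo b
upTo-mono-≤ a≤b = upTo-mono-≤′ (ℕ.≤⇒≤′ a≤b)

sublevel-⊆ : ∀ (f : ℕ → ℕ) {N N'} → N ≤ N' →
  filter (λ k → f k ≤? N) (upTo (suc N)) ⊆ filter (λ k → f k ≤? N') (upTo (suc N'))
sublevel-⊆ f N≤N' =
  filter⁺ (λ k → f k ≤? _) (λ k → f k ≤? _)
          (λ { refl fk≤N → ℕ.≤-trans fk≤N N≤N' })
          (upTo-mono-≤ (s≤s N≤N'))

s-mono : ∀ p j {m i m' i'} → m * (i + 1) ≤ m' * (i' + 1) → s p m i j ≤ s p m' i' j
s-mono p j N≤N' = length-mono-≤ (sublevel-⊆ (λ k → p ^ k * j) N≤N')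

n*[2+i]≤m*[1+i] : ∀ {m n} i → n ≤ m → n ≤ suc i * (m ∸ n) → n * (suc i + 1) ≤ m * (i + 1)
n*[2+i]≤m*[1+i] {m} {n} i n≤m n≤[1+i]d = begin
  n * (suc i + 1)           ≡⟨ ℕ-Solver.solve (n ∷ i ∷ []) ⟩
  n * (i + 1) + n           ≤⟨ ℕ.+-monoʳ-≤ (n * (i + 1)) n≤[1+i]d ⟩
  n * (i + 1) + suc i * d   ≡⟨ regroup n i d ⟩
  (n + d) * (i + 1)         ≡⟨ cong (_* (i + 1)) (ℕ.m+[n∸m]≡n n≤m) ⟩
  m * (i + 1)               ∎
  where
  open ℕ.≤-Reasoning
  d = m ∸ n
  regroup : ∀ n i d → n * (i + 1) + suc i * d ≡ (n + d) * (i + 1)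
  regroup = ℕ-Solver.solve-∀

i≤k⇒j≤k+[j-i] : ∀ {i j k} → i ℤ.≤ k → j ℤ.≤ k ℤ.+ (j ℤ.- i)
i≤k⇒j≤k+[j-i] {i} {j} {k} i≤k = begin
  j                 ≡⟨ ℤ-Solver.solve (i ∷ j ∷ []) ⟩
  i ℤ.+ (j ℤ.- i)   ≤⟨ ℤ.+-monoˡ-≤ (j ℤ.- i) i≤k ⟩
  k ℤ.+ (j ℤ.- i)   ∎
  where open ℤ.≤-Reasoning

lemma6p2 : (p m n i j : ℕ) → Prime p → 1 ≤ n → n < m → 1 ≤ i →
    n ≤ i * (m ∸ n) → 1 ≤ j → ¬ (p ∣ j) →
    (+ s p n (i ∸ 1) j) ℤ.≤ vα p m n (i ∸ 1) j →
    (+ s p n i j) ℤ.≤ vα p m n i j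
lemma6p2 p m n (suc i) j _ _ n<m _ n≤[1+i][m∸n] _ _ s≤vα = begin
  + s p n (suc i) j    ≤⟨ ℤ.+≤+ (s-mono p j {n} {suc i} {m} {i} n[i+2]≤m[i+1]) ⟩
  + s p m i j          ≤⟨ i≤k⇒j≤k+[j-i] s≤vα ⟩
  vα p m n (suc i) j   ∎
  where
  open ℤ.≤-Reasoning
  n[i+2]≤m[i+1] : n * (suc i + 1) ≤ m * (i + 1)
  n[i+2]≤m[i+1] = n*[2+i]≤m*[1+i] i (ℕ.<⇒≤ n<m) n≤[1+i][m∸n]
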